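{- Let $\Gamma=H(d,e)$, $e\ge2$. For each $i=0,1,\dots,d$, the set $\{\pi_i(\imath_v): v\in L'_i\}$ is a basis of the eigenspace $V_i$, where $L'_i$ is the set of words in $L_i$ none of whose nonzero entries equals $e$. In particular $V_1$ has basis $\{\check v: v\in L'_1\}$, where $L'_1$ is the set of words $v_1\cdots v_d$ with $1\le v_i<e$ for some $i$ and $v_j=0$ for all $j\ne i$.
   Context: $H(d,e)$: vertex set $X$ = words of length $d$ over $\{1,\dots,e\}$, adjacent iff differing in exactly one position. Its adjacency matrix has eigenvalues $\theta_0>\cdots>\theta_d$ with eigenspaces $V_0,\dots,V_d\subseteq\mathbb R^X$, and $\pi_i$ is the orthogonal projection onto $V_i$. $L_i$ is the set of words of length $d$ over $\{0,1,\dots,e\}$ with exactly $i$ nonzero entries; for words $u,v$, $u\le v$ iff $u_j\ne0\Rightarrow v_j=u_j$ for all $j$. For $v\in L_i$, $\imath_v:X\to\mathbb R$ is the indicator of $\{x\in X: v\le x\}$, and $\check v:=\pi_1(\imath_v)$.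
   Formalization: Functions on X take values in ℚ rather than ℝ, so this holds also for the eigenspaces $V_i$, the projections $\pi_i$ and the coefficients of linear combinations in the basis claim. -}

module Defs where

open import Data.Nat as ℕ using (ℕ; zero; suc)
open import Data.Fin as Fin using (Fin; zero; suc; toℕ)
open import Data.Vec using (Vec; []; _∷_; lookup)
open import Data.List using (List; []; _∷_; _++_; map; concatMap; foldr)
open import Data.List using (allFin)
open import Data.Bool using (Bool; true; false; if_then_else_)
open import Data.Rational as ℚ using (ℚ; 0ℚ; 1ℚ; _+_; _*_; _-_)
open import Data.Product using (Σ; ∃; _×_; _,_)
open import Relation.Binary.PropositionalEquality using (_≡_; _≢_)
open import Relation.Nullary using (¬_; does)
open import Data.Fin.Properties using () renaming (_≟_ to _≟F_)
open import Data.Nat.Properties using () renaming (_≟_ to _≟ℕ_)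

words : {A : Set} → List A → (d : ℕ) → List (Vec A d)
words as zero    = [] ∷ []
words as (suc d) = concatMap (λ a → map (a ∷_) (words as d)) as

sumL : {A : Set} → List A → (A → ℚ) → ℚ
sumL xs f = foldr (λ x acc → f x + acc) 0ℚ xs

-- The Hamming graph H(d,e).
-- Vertex set X = words of length d over {1,...,e}; the letter k+1 is
-- represented by (k : Fin e).
X : ℕ → ℕ → Set
X d e = Vec (Fin e) d

Xs : (d e : ℕ) → List (X d e)
Xs d e = words (allFin e) d

hamming : ∀ {d e} → Vec (Fin e) d → Vec (Fin e) d → ℕ
hamming []       []       = 0
hamming (a ∷ x) (b ∷ y) = if does (a ≟F b) then hamming x y else suc (hamming x y)

adjB : ∀ {d e} → X d e → X d e → Bool
adjB x y = does (hamming x y ≟ℕ 1)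

-- functions X → ℚ (the paper's ℝ^X, here over ℚ)
Fun : ℕ → ℕ → Set
Fun d e = X d e → ℚ

adjMat : ∀ {d e} → Fun d e → Fun d e
adjMat {d} {e} f x = sumL (Xs d e) (λ y → if adjB x y then f y else 0ℚ)

InEigenspace : ∀ {d e} → ℚ → Fun d e → Set
InEigenspace θ f = ∀ x → adjMat f x ≡ θ * f x

IsEigenvalue : (d e : ℕ) → ℚ → Set
IsEigenvalue d e θ = Σ (Fun d e) λ f → (∃ λ x → f x ≢ 0ℚ) × InEigenspace θ f

inner : ∀ {d e} → Fun d e → Fun d e → ℚ
inner {d} {e} f g = sumL (Xs d e) (λ x → f x * g x)

IsOrthProj : ∀ {d e} → ℚ → Fun d e → Fun d e → Set
IsOrthProj θ f g =
  InEigenspace θ g × (∀ h → InEigenspace θ h → inner (λ x → f x - g x) h ≡ 0ℚ)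

IsEigenvalueList : (d e : ℕ) → (Fin (suc d) → ℚ) → Set
IsEigenvalueList d e θ =
  (∀ i j → toℕ i ℕ.< toℕ j → θ j ℚ.< θ i) ×
  (∀ i → IsEigenvalue d e (θ i)) ×
  (∀ μ → IsEigenvalue d e μ → ∃ λ i → μ ≡ θ i)

-- Words over {0,1,...,e}: (zero : Fin (suc e)) is the letter 0 and
-- (suc k) is the letter k+1.
W : ℕ → ℕ → Set
W d e = Vec (Fin (suc e)) d

Ws : (d e : ℕ) → List (W d e)
Ws d e = words (allFin (suc e)) d

nonzeroCount : ∀ {d e} → W d e → ℕ
nonzeroCount []           = 0
nonzeroCount (zero  ∷ v) = nonzeroCount v
nonzeroCount (suc _ ∷ v) = suc (nonzeroCount v)

leB : ∀ {d e} → W d e → X d e → Bool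
leB []           []       = true
leB (zero  ∷ u) (_ ∷ x) = leB u x
leB (suc a ∷ u) (b ∷ x) = if does (a ≟F b) then leB u x else false

indic : ∀ {d e} → W d e → Fun d e
indic v x = if leB v x then 1ℚ else 0ℚ

noLetterEB : ∀ {d e} → W d e → Bool
noLetterEB []      = true
noLetterEB {e = e} (a ∷ v) = if does (a ≟F Fin.fromℕ e) then false else noLetterEB v

inL'B : ∀ {d e} → ℕ → W d e → Bool
inL'B i v = if does (nonzeroCount v ≟ℕ i) then noLetterEB v else false

InL' : ∀ {d e} → ℕ → W d e → Set
InL' i v = inL'B i v ≡ true

linComb : ∀ {d e} → ℕ → (W d e → ℚ) → (W d e → Fun d e) → Fun d e
linComb {d} {e} i c b x =
  sumL (Ws d e) (λ v → if inL'B i v then c v * b v x else 0ℚ)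

IsBasisL' : ∀ {d e} → ℕ → ℚ → (W d e → Fun d e) → Set
IsBasisL' {d} {e} i θ b =
  (∀ v → InL' i v → InEigenspace θ (b v)) ×
  (∀ (c : W d e → ℚ) → (∀ x → linComb i c b x ≡ 0ℚ) → ∀ v → InL' i v → c v ≡ 0ℚ) ×
  (∀ f → InEigenspace θ f → ∃ λ (c : W d e → ℚ) → ∀ x → f x ≡ linComb i c b x)

-- On a single coordinate, the functions 1 and δ_c − 1/e are eigenvectors of the complete graph
-- K_e for e − 1 and −1, and the indicator of the letter c splits as 1/e + (δ_c − 1/e).  Since
-- H(d,e) is the d-th Cartesian power of K_e, tensor products of such factors are eigenvectors
-- of H(d,e) with additive eigenvalues; in particular π_v, the product of 1 over the zero
-- positions of v and δ_{v_j} − 1/e over the others, lies in the eigenspace for d(e−1) − e·|v|.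
-- Over the words v without the letter e, the π_v form a basis of ℚ^X whose dual basis ψ_v is
-- again of tensor form (factors 1/e and δ_c − δ_e).  Expanding an eigenvector f as
-- Σ ⟨ψ_v, f⟩ π_v, self-adjointness kills every coefficient with a different eigenvalue: hence
-- θ_k = d(e−1) − ke, {π_v : v ∈ L'_k} spans V_k, and duality gives independence.  Finally
-- ⟨ı_v, π_w⟩ = ⟨π_v, π_w⟩ whenever |v| ≤ |w|, so ı_v − π_v ⊥ V_k and π_v = π_k(ı_v).
module Submission where

open import Defs
open import Data.Nat using (ℕ; suc; _≤_)
open import Data.Fin using (Fin; toℕ)
open import Data.Rational using (ℚ)
open import Data.Product using (Σ; ∃; _×_)

open import Data.Nat as ℕ using (zero; z≤n; s≤s)
import Data.Nat.Properties as ℕ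
open import Data.Fin as Fin using (zero; suc; fromℕ; fromℕ<)
import Data.Fin.Properties as Fin
open import Data.Vec using (Vec; []; _∷_)
open import Data.List using (List; []; _∷_; _++_; map; concatMap; allFin)
import Data.List.Properties as List
open import Data.Bool using (true; false; if_then_else_)
open import Data.Rational as ℚ using (0ℚ; 1ℚ; _+_; _*_; _-_; -_; 1/_)
import Data.Rational.Properties as ℚ
open import Data.Rational.Solver using (module +-*-Solver)
open import Data.Product using (_,_; proj₁; proj₂)
open import Data.Sum using (inj₁; inj₂)
open import Data.Empty using (⊥-elim)
open import Function using (_∘_; id)
open import Relation.Nullary using (Dec; does; yes; no)
open import Relation.Nullary.Decidable using (from-yes)
open import Relation.Binary.Definitions using (tri<; tri≈; tri>)
open import Relation.Binary.PropositionalEquality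
open +-*-Solver

module _ {A : Set} where

  sumL-cong : (xs : List A) {f g : A → ℚ} → (∀ x → f x ≡ g x) → sumL xs f ≡ sumL xs g
  sumL-cong []       eq = refl
  sumL-cong (x ∷ xs) eq = cong₂ _+_ (eq x) (sumL-cong xs eq)

  sumL-0 : (xs : List A) → sumL xs (λ _ → 0ℚ) ≡ 0ℚ
  sumL-0 []       = refl
  sumL-0 (x ∷ xs) = trans (cong (0ℚ +_) (sumL-0 xs)) (ℚ.+-identityˡ 0ℚ)

  sumL-≡0 : (xs : List A) {f : A → ℚ} → (∀ x → f x ≡ 0ℚ) → sumL xs f ≡ 0ℚ
  sumL-≡0 xs eq = trans (sumL-cong xs eq) (sumL-0 xs)

  sumL-+ : (xs : List A) (f g : A → ℚ) → sumL xs (λ x → f x + g x) ≡ sumL xs f + sumL xs g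
  sumL-+ []       f g = sym (ℚ.+-identityˡ 0ℚ)
  sumL-+ (x ∷ xs) f g = trans (cong (f x + g x +_) (sumL-+ xs f g))
    (solve 4 (λ a b c d → (a :+ b) :+ (c :+ d) := (a :+ c) :+ (b :+ d)) refl
      (f x) (g x) (sumL xs f) (sumL xs g))

  sumL-neg : (xs : List A) (f : A → ℚ) → sumL xs (λ x → - f x) ≡ - sumL xs f
  sumL-neg []       f = refl
  sumL-neg (x ∷ xs) f = trans (cong (- f x +_) (sumL-neg xs f))
    (solve 2 (λ a b → (:- a) :+ (:- b) := :- (a :+ b)) refl (f x) (sumL xs f))

  sumL-sub : (xs : List A) (f g : A → ℚ) → sumL xs (λ x → f x - g x) ≡ sumL xs f - sumL xs g
  sumL-sub xs f g = trans (sumL-+ xs f (λ x → - g x)) (cong (sumL xs f +_) (sumL-neg xs g))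

  sumL-*ˡ : (xs : List A) (c : ℚ) (f : A → ℚ) → sumL xs (λ x → c * f x) ≡ c * sumL xs f
  sumL-*ˡ []       c f = sym (ℚ.*-zeroʳ c)
  sumL-*ˡ (x ∷ xs) c f =
    trans (cong (c * f x +_) (sumL-*ˡ xs c f)) (sym (ℚ.*-distribˡ-+ c (f x) (sumL xs f)))

  sumL-*ʳ : (xs : List A) (c : ℚ) (f : A → ℚ) → sumL xs (λ x → f x * c) ≡ sumL xs f * c
  sumL-*ʳ xs c f = trans (sumL-cong xs (λ x → ℚ.*-comm (f x) c))
    (trans (sumL-*ˡ xs c f) (ℚ.*-comm c (sumL xs f)))

  sumL-++ : (xs ys : List A) (f : A → ℚ) → sumL (xs ++ ys) f ≡ sumL xs f + sumL ys f
  sumL-++ []       ys f = sym (ℚ.+-identityˡ (sumL ys f))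
  sumL-++ (x ∷ xs) ys f =
    trans (cong (f x +_) (sumL-++ xs ys f)) (sym (ℚ.+-assoc (f x) (sumL xs f) (sumL ys f)))

module _ {A B : Set} where

  sumL-map : (xs : List A) (h : A → B) (f : B → ℚ) → sumL (map h xs) f ≡ sumL xs (f ∘ h)
  sumL-map []       h f = refl
  sumL-map (x ∷ xs) h f = cong (f (h x) +_) (sumL-map xs h f)

  sumL-concatMap : (xs : List A) (h : A → List B) (f : B → ℚ) →
    sumL (concatMap h xs) f ≡ sumL xs (λ a → sumL (h a) f)
  sumL-concatMap []       h f = refl
  sumL-concatMap (x ∷ xs) h f = trans (sumL-++ (h x) (concatMap h xs) f)
    (cong (sumL (h x) f +_) (sumL-concatMap xs h f))

  sumL-swap : (xs : List A) (ys : List B) (F : A → B → ℚ) →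
    sumL xs (λ x → sumL ys (F x)) ≡ sumL ys (λ y → sumL xs (λ x → F x y))
  sumL-swap []       ys F = sym (sumL-0 ys)
  sumL-swap (x ∷ xs) ys F = trans (cong (sumL ys (F x) +_) (sumL-swap xs ys F))
    (sym (sumL-+ ys (F x) (λ y → sumL xs (λ x → F x y))))

sumL-allFin-suc : ∀ n (f : Fin (suc n) → ℚ) →
  sumL (allFin (suc n)) f ≡ f zero + sumL (allFin n) (f ∘ suc)
sumL-allFin-suc n f = cong (f zero +_)
  (trans (cong (λ xs → sumL xs f) (sym (List.map-tabulate id suc))) (sumL-map (allFin n) suc f))

sumL-words-suc : ∀ {A : Set} (as : List A) d (f : Vec A (suc d) → ℚ) →
  sumL (words as (suc d)) f ≡ sumL as (λ a → sumL (words as d) (λ w → f (a ∷ w)))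
sumL-words-suc as d f = trans (sumL-concatMap as (λ a → map (a ∷_) (words as d)) f)
  (sumL-cong as (λ a → sumL-map (words as d) (a ∷_) f))

toℚ : ℕ → ℚ
toℚ zero    = 0ℚ
toℚ (suc n) = 1ℚ + toℚ n

sumL-const : ∀ n (c : ℚ) → sumL (allFin n) (λ _ → c) ≡ toℚ n * c
sumL-const zero    c = sym (ℚ.*-zeroˡ c)
sumL-const (suc n) c = trans (sumL-allFin-suc n (λ _ → c)) (trans (cong (c +_) (sumL-const n c))
  (solve 2 (λ c x → c :+ x :* c := (con 1ℚ :+ x) :* c) refl c (toℚ n)))

toℚ-<-suc : ∀ n → toℚ n ℚ.< toℚ (suc n)
toℚ-<-suc n = subst (ℚ._< 1ℚ + toℚ n) (ℚ.+-identityˡ (toℚ n))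
  (ℚ.+-monoˡ-< (toℚ n) (from-yes (0ℚ ℚ.<? 1ℚ)))

toℚ-mono-< : ∀ {k k′} → k ℕ.< k′ → toℚ k ℚ.< toℚ k′
toℚ-mono-< {k} {suc k′} (s≤s k≤k′) with ℕ.m≤n⇒m<n∨m≡n k≤k′
... | inj₁ k<k′ = ℚ.<-trans (toℚ-mono-< k<k′) (toℚ-<-suc k′)
... | inj₂ refl = toℚ-<-suc k

*-eqʳ⇒≡0 : ∀ a b c → a * c ≡ b * c → a ≢ b → c ≡ 0ℚ
*-eqʳ⇒≡0 a b c eq a≢b with c ℚ.≟ 0ℚ
... | yes c≡0 = c≡0
... | no  c≢0 = ⊥-elim (a≢b (trans (sym (cancel a)) (trans (cong (_* 1/ c) eq) (cancel b))))
  where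
  instance
    _ : ℚ.NonZero c
    _ = ℚ.≢-nonZero c≢0
  cancel : ∀ x → x * c * 1/ c ≡ x
  cancel x = trans (ℚ.*-assoc x c (1/ c)) (trans (cong (x *_) (ℚ.*-inverseʳ c)) (ℚ.*-identityʳ x))

*-≡0ˡ : ∀ {a} b → a ≡ 0ℚ → a * b ≡ 0ℚ
*-≡0ˡ b refl = ℚ.*-zeroˡ b

*-≡0ʳ : ∀ a {b} → b ≡ 0ℚ → a * b ≡ 0ℚ
*-≡0ʳ a refl = ℚ.*-zeroʳ a

if-then-≡0 : ∀ t {q} → (t ≡ true → q ≡ 0ℚ) → (if t then q else 0ℚ) ≡ 0ℚ
if-then-≡0 true  q≡0 = q≡0 refl
if-then-≡0 false _   = refl

if-does-elim : ∀ {P : Set} (P? : Dec P) {b} → (if does P? then b else false) ≡ true → P × b ≡ true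
if-does-elim (yes p) b≡true = p , b≡true
if-does-elim (no  _) ()

if-does-intro : ∀ {P : Set} (P? : Dec P) {b} → P → b ≡ true → (if does P? then b else false) ≡ true
if-does-intro (yes _) _ b≡true = b≡true
if-does-intro (no ¬p) p _      = ⊥-elim (¬p p)

module _ {n : ℕ} (σ : Fin (suc n) → Fin (suc n))
         (increasing : ∀ i j → i Fin.< j → σ i Fin.< σ j) where

  private
    displacement : ∀ k {i j} → toℕ i ℕ.+ k ≡ toℕ j → toℕ (σ i) ℕ.+ k ≤ toℕ (σ j)
    displacement zero {i} {j} eq = ℕ.≤-reflexive (trans (ℕ.+-identityʳ (toℕ (σ i)))
      (cong (toℕ ∘ σ) (Fin.toℕ-injective (trans (sym (ℕ.+-identityʳ (toℕ i))) eq))))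
    displacement (suc k) {i} {j} eq = begin
      toℕ (σ i) ℕ.+ suc k   ≡⟨ ℕ.+-suc (toℕ (σ i)) k ⟩
      suc (toℕ (σ i) ℕ.+ k) ≤⟨ s≤s (displacement k (sym (Fin.toℕ-fromℕ< j′<1+n))) ⟩
      suc (toℕ (σ j′))      ≤⟨ increasing j′ j (subst (ℕ._< toℕ j) (sym (Fin.toℕ-fromℕ< j′<1+n)) i+k<j) ⟩
      toℕ (σ j)             ∎
      where
      open ℕ.≤-Reasoning
      i+k<j : toℕ i ℕ.+ k ℕ.< toℕ j
      i+k<j = subst (toℕ i ℕ.+ k ℕ.<_) (trans (sym (ℕ.+-suc (toℕ i) k)) eq) (ℕ.n<1+n (toℕ i ℕ.+ k))
      j′<1+n : toℕ i ℕ.+ k ℕ.< suc n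
      j′<1+n = ℕ.<-trans i+k<j (Fin.toℕ<n j)
      j′ : Fin (suc n)
      j′ = fromℕ< j′<1+n

  strictlyIncreasing⇒≡id : ∀ i → σ i ≡ i
  strictlyIncreasing⇒≡id i = Fin.toℕ-injective (ℕ.≤-antisym upper lower)
    where
    open ℕ.≤-Reasoning
    i≤n : toℕ i ≤ n
    i≤n = Fin.toℕ≤pred[n] i
    lower : toℕ i ≤ toℕ (σ i)
    lower = ℕ.≤-trans (ℕ.m≤n+m (toℕ i) (toℕ (σ zero))) (displacement (toℕ i) {zero} refl)
    upper : toℕ (σ i) ≤ toℕ i
    upper = ℕ.+-cancelʳ-≤ (n ℕ.∸ toℕ i) (toℕ (σ i)) (toℕ i) (begin
      toℕ (σ i) ℕ.+ (n ℕ.∸ toℕ i)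
        ≤⟨ displacement (n ℕ.∸ toℕ i) (trans (ℕ.m+[n∸m]≡n i≤n) (sym (Fin.toℕ-fromℕ n))) ⟩
      toℕ (σ (fromℕ n))     ≤⟨ Fin.toℕ≤pred[n] (σ (fromℕ n)) ⟩
      n                     ≡⟨ ℕ.m+[n∸m]≡n i≤n ⟨
      toℕ i ℕ.+ (n ℕ.∸ toℕ i) ∎)

δ : ∀ {n} → Fin n → Fin n → ℚ
δ a b = if does (a Fin.≟ b) then 1ℚ else 0ℚ

does-≟-sym : ∀ {n} (a b : Fin n) → does (a Fin.≟ b) ≡ does (b Fin.≟ a)
does-≟-sym zero    zero    = refl
does-≟-sym zero    (suc b) = refl
does-≟-sym (suc a) zero    = refl
does-≟-sym (suc a) (suc b) = does-≟-sym a b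

δ-sym : ∀ {n} (a b : Fin n) → δ a b ≡ δ b a
δ-sym a b = cong (λ t → if t then 1ℚ else 0ℚ) (does-≟-sym a b)

sumL-δ : ∀ n (a : Fin n) (G : Fin n → ℚ) → sumL (allFin n) (λ b → δ a b * G b) ≡ G a
sumL-δ (suc n) zero G = trans (sumL-allFin-suc n (λ b → δ zero b * G b))
  (trans (cong (1ℚ * G zero +_) (sumL-≡0 (allFin n) (λ b → ℚ.*-zeroˡ (G (suc b)))))
  (trans (ℚ.+-identityʳ (1ℚ * G zero)) (ℚ.*-identityˡ (G zero))))
sumL-δ (suc n) (suc a) G = trans (sumL-allFin-suc n (λ b → δ (suc a) b * G b))
  (trans (cong₂ _+_ (ℚ.*-zeroˡ (G zero)) (sumL-δ n a (G ∘ suc))) (ℚ.+-identityˡ (G (suc a))))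

sumL-δ₁ : ∀ n (a : Fin n) → sumL (allFin n) (δ a) ≡ 1ℚ
sumL-δ₁ n a = trans (sumL-cong (allFin n) (λ b → sym (ℚ.*-identityʳ (δ a b))))
  (sumL-δ n a (λ _ → 1ℚ))

sumL-δ-δ : ∀ n (p q : Fin n) (G : Fin n → ℚ) →
  sumL (allFin n) (λ a → (δ p a - δ q a) * G a) ≡ G p - G q
sumL-δ-δ n p q G = trans
  (sumL-cong (allFin n) (λ a → solve 3 (λ x y g → (x :- y) :* g := x :* g :- y :* g) refl (δ p a) (δ q a) (G a)))
  (trans (sumL-sub (allFin n) (λ a → δ p a * G a) (λ a → δ q a * G a)) (cong₂ _-_ (sumL-δ n p G) (sumL-δ n q G)))

δV : ∀ {n d} → Vec (Fin n) d → Vec (Fin n) d → ℚ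
δV []      []      = 1ℚ
δV (a ∷ x) (b ∷ y) = δ a b * δV x y

sumL-δV : ∀ n d (x : Vec (Fin n) d) (G : Vec (Fin n) d → ℚ) →
  sumL (words (allFin n) d) (λ y → δV x y * G y) ≡ G x
sumL-δV n zero    []      G = trans (ℚ.+-identityʳ (1ℚ * G [])) (ℚ.*-identityˡ (G []))
sumL-δV n (suc d) (a ∷ x) G = trans (sumL-words-suc (allFin n) d (λ y → δV (a ∷ x) y * G y))
  (trans (sumL-cong (allFin n) (λ b → trans
      (sumL-cong (words (allFin n) d) (λ y → ℚ.*-assoc (δ a b) (δV x y) (G (b ∷ y))))
      (trans (sumL-*ˡ (words (allFin n) d) (δ a b) (λ y → δV x y * G (b ∷ y)))
             (cong (δ a b *_) (sumL-δV n d x (λ y → G (b ∷ y)))))))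
  (sumL-δ n a (λ b → G (b ∷ x))))

module _ {d e : ℕ} where

  inner-congˡ : {f f′ : Fun d e} (g : Fun d e) → (∀ x → f x ≡ f′ x) → inner f g ≡ inner f′ g
  inner-congˡ g eq = sumL-cong (Xs d e) (λ x → cong (_* g x) (eq x))

  inner-congʳ : (f : Fun d e) {g g′ : Fun d e} → (∀ x → g x ≡ g′ x) → inner f g ≡ inner f g′
  inner-congʳ f eq = sumL-cong (Xs d e) (λ x → cong (f x *_) (eq x))

  inner-comm : (f g : Fun d e) → inner f g ≡ inner g f
  inner-comm f g = sumL-cong (Xs d e) (λ x → ℚ.*-comm (f x) (g x))

  inner-*ʳ : (f g : Fun d e) (c : ℚ) → inner f (λ x → c * g x) ≡ c * inner f g
  inner-*ʳ f g c = trans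
    (sumL-cong (Xs d e) (λ x → solve 3 (λ a b c → a :* (c :* b) := c :* (a :* b)) refl (f x) (g x) c))
    (sumL-*ˡ (Xs d e) c (λ x → f x * g x))

  inner-*ˡ : (f g : Fun d e) (c : ℚ) → inner (λ x → c * f x) g ≡ c * inner f g
  inner-*ˡ f g c = trans (inner-comm (λ x → c * f x) g)
    (trans (inner-*ʳ g f c) (cong (c *_) (inner-comm g f)))

  inner-subˡ : (f f′ g : Fun d e) → inner (λ x → f x - f′ x) g ≡ inner f g - inner f′ g
  inner-subˡ f f′ g = trans
    (sumL-cong (Xs d e) (λ x → solve 3 (λ a b c → (a :- b) :* c := a :* c :- b :* c) refl (f x) (f′ x) (g x)))
    (sumL-sub (Xs d e) (λ x → f x * g x) (λ x → f′ x * g x))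

  inner-linComb : ∀ k (f : Fun d e) (c : W d e → ℚ) (b : W d e → Fun d e) →
    inner f (linComb k c b) ≡ sumL (Ws d e) (λ v → if inL'B k v then c v * inner f (b v) else 0ℚ)
  inner-linComb k f c b =
    trans (sumL-cong (Xs d e) (λ x → sym (sumL-*ˡ (Ws d e) (f x) (λ v → if inL'B k v then c v * b v x else 0ℚ))))
    (trans (sumL-swap (Xs d e) (Ws d e) (λ x v → f x * (if inL'B k v then c v * b v x else 0ℚ)))
    (sumL-cong (Ws d e) summand))
    where
    summand : ∀ v → sumL (Xs d e) (λ x → f x * (if inL'B k v then c v * b v x else 0ℚ))
                  ≡ (if inL'B k v then c v * inner f (b v) else 0ℚ)
    summand v with inL'B k v
    ... | true  = trans
      (sumL-cong (Xs d e) (λ x → solve 3 (λ a b c → a :* (c :* b) := c :* (a :* b)) refl (f x) (b v x) (c v)))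
      (sumL-*ˡ (Xs d e) (c v) (λ x → f x * b v x))
    ... | false = sumL-≡0 (Xs d e) (λ x → ℚ.*-zeroʳ (f x))

completeAdj : ∀ {e} → (Fin e → ℚ) → Fin e → ℚ
completeAdj {e} f a = sumL (allFin e) (λ b → if does (a Fin.≟ b) then 0ℚ else f b)

module _ {e : ℕ} where

  completeAdj≡sum- : (f : Fin e → ℚ) (a : Fin e) → completeAdj f a ≡ sumL (allFin e) f - f a
  completeAdj≡sum- f a = trans (sumL-cong (allFin e) without-a)
    (trans (sumL-sub (allFin e) f (λ b → δ a b * f b)) (cong (λ z → sumL (allFin e) f - z) (sumL-δ e a f)))
    where
    without-a : ∀ b → (if does (a Fin.≟ b) then 0ℚ else f b) ≡ f b - δ a b * f b
    without-a b with does (a Fin.≟ b)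
    ... | true  = solve 1 (λ x → con 0ℚ := x :- con 1ℚ :* x) refl (f b)
    ... | false = solve 1 (λ x → x := x :- con 0ℚ :* x) refl (f b)

  completeAdj-sumZero : (f : Fin e → ℚ) → sumL (allFin e) f ≡ 0ℚ →
    ∀ a → completeAdj f a ≡ - 1ℚ * f a
  completeAdj-sumZero f Σf≡0 a = trans (completeAdj≡sum- f a) (trans (cong (_- f a) Σf≡0)
    (solve 1 (λ x → con 0ℚ :- x := (:- con 1ℚ) :* x) refl (f a)))

  completeAdj-const : ∀ (κ : ℚ) a → completeAdj (λ _ → κ) a ≡ (toℚ e - 1ℚ) * κ
  completeAdj-const κ a = trans (completeAdj≡sum- (λ _ → κ) a) (trans (cong (_- κ) (sumL-const e κ))
    (solve 2 (λ n k → n :* k :- k := (n :- con 1ℚ) :* k) refl (toℚ e) κ))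

  completeAdj-*ʳ : (f : Fin e → ℚ) (c : ℚ) (a : Fin e) →
    completeAdj (λ b → f b * c) a ≡ completeAdj f a * c
  completeAdj-*ʳ f c a = trans (sumL-cong (allFin e) without-a)
    (sumL-*ʳ (allFin e) c (λ b → if does (a Fin.≟ b) then 0ℚ else f b))
    where
    without-a : ∀ b → (if does (a Fin.≟ b) then 0ℚ else f b * c) ≡ (if does (a Fin.≟ b) then 0ℚ else f b) * c
    without-a b with does (a Fin.≟ b)
    ... | true  = sym (ℚ.*-zeroˡ c)
    ... | false = refl

  hamming-sym : ∀ {d} (x y : X d e) → hamming x y ≡ hamming y x
  hamming-sym []      []      = refl
  hamming-sym (a ∷ x) (b ∷ y) rewrite does-≟-sym a b | hamming-sym x y = refl

  adjB-sym : ∀ {d} (x y : X d e) → adjB x y ≡ adjB y x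
  adjB-sym x y = cong (λ h → does (h ℕ.≟ 1)) (hamming-sym x y)

  δV-hamming : ∀ {d} (x y : X d e) → (if does (hamming x y ℕ.≟ 0) then 1ℚ else 0ℚ) ≡ δV x y
  δV-hamming []      []      = refl
  δV-hamming (a ∷ x) (b ∷ y) with does (a Fin.≟ b)
  ... | true  = trans (δV-hamming x y) (sym (ℚ.*-identityˡ (δV x y)))
  ... | false = sym (ℚ.*-zeroˡ (δV x y))

  sumL-hamming-zero : ∀ {d} (x : X d e) (G : Fun d e) →
    sumL (Xs d e) (λ y → if does (hamming x y ℕ.≟ 0) then G y else 0ℚ) ≡ G x
  sumL-hamming-zero {d} x G = trans (sumL-cong (Xs d e) (λ y → trans (if-as-* (does (hamming x y ℕ.≟ 0)) (G y))
      (cong (_* G y) (δV-hamming x y))))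
    (sumL-δV e d x G)
    where
    if-as-* : ∀ t q → (if t then q else 0ℚ) ≡ (if t then 1ℚ else 0ℚ) * q
    if-as-* true  q = sym (ℚ.*-identityˡ q)
    if-as-* false q = sym (ℚ.*-zeroˡ q)

  adjMat-*ˡ : ∀ {d} (c : ℚ) (f : Fun d e) x → adjMat (λ y → c * f y) x ≡ c * adjMat f x
  adjMat-*ˡ {d} c f x = trans (sumL-cong (Xs d e) (λ y → pull-c (adjB x y) (f y)))
    (sumL-*ˡ (Xs d e) c (λ y → if adjB x y then f y else 0ℚ))
    where
    pull-c : ∀ t q → (if t then c * q else 0ℚ) ≡ c * (if t then q else 0ℚ)
    pull-c true  q = refl
    pull-c false q = sym (ℚ.*-zeroʳ c)

  adjMat-sub : ∀ {d} (f g : Fun d e) x → adjMat (λ y → f y - g y) x ≡ adjMat f x - adjMat g x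
  adjMat-sub {d} f g x = trans (sumL-cong (Xs d e) (λ y → split (adjB x y) (f y) (g y)))
    (sumL-sub (Xs d e) (λ y → if adjB x y then f y else 0ℚ) (λ y → if adjB x y then g y else 0ℚ))
    where
    split : ∀ t p q → (if t then p - q else 0ℚ) ≡ (if t then p else 0ℚ) - (if t then q else 0ℚ)
    split true  p q = refl
    split false p q = sym (ℚ.+-inverseʳ 0ℚ)

  -- H(d+1,e) is the Cartesian product of H(d,e) and K_e.
  adjMat-∷ : ∀ {d} (f : Fun (suc d) e) a x →
    adjMat f (a ∷ x) ≡ adjMat (λ y → f (a ∷ y)) x + completeAdj (λ b → f (b ∷ x)) a
  adjMat-∷ {d} f a x = trans (sumL-words-suc (allFin e) d (λ y → if adjB (a ∷ x) y then f y else 0ℚ))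
    (trans (sumL-cong (allFin e) column)
    (trans (sumL-+ (allFin e) (λ b → δ a b * adjMat (λ y → f (b ∷ y)) x)
                              (λ b → if does (a Fin.≟ b) then 0ℚ else f (b ∷ x)))
    (cong (_+ completeAdj (λ b → f (b ∷ x)) a) (sumL-δ e a (λ b → adjMat (λ y → f (b ∷ y)) x)))))
    where
    column : ∀ b → sumL (Xs d e) (λ y → if adjB (a ∷ x) (b ∷ y) then f (b ∷ y) else 0ℚ)
                 ≡ δ a b * adjMat (λ y → f (b ∷ y)) x + (if does (a Fin.≟ b) then 0ℚ else f (b ∷ x))
    column b with does (a Fin.≟ b)
    ... | true  = sym (trans (ℚ.+-identityʳ (1ℚ * adjMat (λ y → f (b ∷ y)) x))
                             (ℚ.*-identityˡ (adjMat (λ y → f (b ∷ y)) x)))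
    ... | false = trans (sumL-hamming-zero x (λ y → f (b ∷ y)))
      (sym (trans (cong (_+ f (b ∷ x)) (ℚ.*-zeroˡ (adjMat (λ y → f (b ∷ y)) x))) (ℚ.+-identityˡ (f (b ∷ x)))))

  adjMat-selfAdjoint : ∀ {d} (f g : Fun d e) → inner (adjMat f) g ≡ inner f (adjMat g)
  adjMat-selfAdjoint {d} f g =
    trans (sumL-cong (Xs d e) (λ x → trans (sym (sumL-*ʳ (Xs d e) (g x) (λ y → if adjB x y then f y else 0ℚ)))
                                           (sumL-cong (Xs d e) (entry x))))
    (trans (sumL-swap (Xs d e) (Xs d e) (λ x y → f y * (if adjB y x then g x else 0ℚ)))
    (sumL-cong (Xs d e) (λ y → sumL-*ˡ (Xs d e) (f y) (λ x → if adjB y x then g x else 0ℚ))))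
    where
    entry : ∀ x y → (if adjB x y then f y else 0ℚ) * g x ≡ f y * (if adjB y x then g x else 0ℚ)
    entry x y rewrite adjB-sym x y with adjB y x
    ... | true  = refl
    ... | false = trans (ℚ.*-zeroˡ (g x)) (sym (ℚ.*-zeroʳ (f y)))

tensor : ∀ {n e d} → (Fin n → Fin e → ℚ) → Vec (Fin n) d → Fun d e
tensor F []      []      = 1ℚ
tensor F (α ∷ v) (a ∷ x) = F α a * tensor F v x

tensorEigenvalue : ∀ {n d} → (Fin n → ℚ) → Vec (Fin n) d → ℚ
tensorEigenvalue μ []      = 0ℚ
tensorEigenvalue μ (α ∷ v) = μ α + tensorEigenvalue μ v

inner₁ : ∀ {n e} → (Fin n → Fin e → ℚ) → (Fin n → Fin e → ℚ) → Fin n → Fin n → ℚ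
inner₁ {e = e} F G α β = sumL (allFin e) (λ a → F α a * G β a)

factorwiseInner : ∀ {n e d} → (Fin n → Fin e → ℚ) → (Fin n → Fin e → ℚ) →
  Vec (Fin n) d → Vec (Fin n) d → ℚ
factorwiseInner F G []      []      = 1ℚ
factorwiseInner F G (α ∷ v) (β ∷ w) = inner₁ F G α β * factorwiseInner F G v w

module _ {n e : ℕ} (F G : Fin n → Fin e → ℚ) where

  inner-tensor : ∀ {d} (v w : Vec (Fin n) d) →
    inner (tensor {e = e} F v) (tensor G w) ≡ factorwiseInner F G v w
  inner-tensor []      []      = trans (ℚ.+-identityʳ (1ℚ * 1ℚ)) (ℚ.*-identityˡ 1ℚ)
  inner-tensor {suc d} (α ∷ v) (β ∷ w) =
    trans (sumL-words-suc (allFin e) d (λ x → tensor F (α ∷ v) x * tensor G (β ∷ w) x))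
    (trans (sumL-cong (allFin e) column)
    (sumL-*ʳ (allFin e) (factorwiseInner F G v w) (λ a → F α a * G β a)))
    where
    column : ∀ a → sumL (Xs d e) (λ x → (F α a * tensor F v x) * (G β a * tensor G w x))
                 ≡ (F α a * G β a) * factorwiseInner F G v w
    column a = trans (sumL-cong (Xs d e) (λ x →
        solve 4 (λ p q r s → (p :* q) :* (r :* s) := (p :* r) :* (q :* s)) refl
          (F α a) (tensor F v x) (G β a) (tensor G w x)))
      (trans (sumL-*ˡ (Xs d e) (F α a * G β a) (λ x → tensor F v x * tensor G w x))
             (cong (F α a * G β a *_) (inner-tensor v w)))

module _ {n e : ℕ} (F : Fin n → Fin e → ℚ) (μ : Fin n → ℚ)
         (F-eigen : ∀ α a → completeAdj (F α) a ≡ μ α * F α a) where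

  tensor-eigen : ∀ {d} (v : Vec (Fin n) d) → InEigenspace (tensorEigenvalue μ v) (tensor F v)
  tensor-eigen []      []      = trans (ℚ.+-identityˡ 0ℚ) (sym (ℚ.*-zeroˡ 1ℚ))
  tensor-eigen (α ∷ v) (a ∷ x) = begin
    adjMat (tensor F (α ∷ v)) (a ∷ x)
      ≡⟨ adjMat-∷ (tensor F (α ∷ v)) a x ⟩
    adjMat (λ y → F α a * tensor F v y) x + completeAdj (λ b → F α b * tensor F v x) a
      ≡⟨ cong₂ _+_ (adjMat-*ˡ (F α a) (tensor F v) x) (completeAdj-*ʳ (F α) (tensor F v x) a) ⟩
    F α a * adjMat (tensor F v) x + completeAdj (F α) a * tensor F v x
      ≡⟨ cong₂ (λ p q → F α a * p + q * tensor F v x) (tensor-eigen v x) (F-eigen α a) ⟩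
    F α a * (tensorEigenvalue μ v * tensor F v x) + μ α * F α a * tensor F v x
      ≡⟨ solve 4 (λ f l t u → f :* (l :* t) :+ u :* f :* t := (u :+ l) :* (f :* t)) refl
           (F α a) (tensorEigenvalue μ v) (tensor F v x) (μ α) ⟩
    tensorEigenvalue μ (α ∷ v) * tensor F (α ∷ v) (a ∷ x) ∎
    where open ≡-Reasoning

nonzeroCount≤ : ∀ {d e} (v : W d e) → nonzeroCount v ≤ d
nonzeroCount≤ []          = z≤n
nonzeroCount≤ (zero  ∷ v) = ℕ.m≤n⇒m≤1+n (nonzeroCount≤ v)
nonzeroCount≤ (suc _ ∷ v) = s≤s (nonzeroCount≤ v)

module HammingFactors (m : ℕ) where

  e : ℕ
  e = suc m

  E : ℚ
  E = toℚ e

  instance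
    E-positive : ℚ.Positive E
    E-positive = ℚ.positive (toℚ-mono-< {0} {e} (s≤s z≤n))

    E-nonZero : ℚ.NonZero E
    E-nonZero = ℚ.pos⇒nonZero E

  E⁻¹ : ℚ
  E⁻¹ = 1/ E

  lastLetter : Fin e
  lastLetter = fromℕ m

  indicatorFactor projFactor dualFactor : Fin (suc e) → Fin e → ℚ
  indicatorFactor zero    a = 1ℚ
  indicatorFactor (suc c) a = δ c a
  projFactor      zero    a = 1ℚ
  projFactor      (suc c) a = δ c a - E⁻¹
  dualFactor      zero    a = E⁻¹
  dualFactor      (suc c) a = δ c a - δ lastLetter a

  factorEigenvalue : Fin (suc e) → ℚ
  factorEigenvalue zero    = E - 1ℚ
  factorEigenvalue (suc c) = - 1ℚ

  sumL-projFactor : ∀ c → sumL (allFin e) (projFactor (suc c)) ≡ 0ℚ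
  sumL-projFactor c = trans (sumL-sub (allFin e) (δ c) (λ _ → E⁻¹))
    (trans (cong₂ _-_ (sumL-δ₁ e c) (trans (sumL-const e E⁻¹) (ℚ.*-inverseʳ E))) (ℚ.+-inverseʳ 1ℚ))

  sumL-dualFactor : ∀ c → sumL (allFin e) (dualFactor (suc c)) ≡ 0ℚ
  sumL-dualFactor c = trans (sumL-sub (allFin e) (δ c) (δ lastLetter))
    (trans (cong₂ _-_ (sumL-δ₁ e c) (sumL-δ₁ e lastLetter)) (ℚ.+-inverseʳ 1ℚ))

  projFactor-eigen : ∀ α a → completeAdj (projFactor α) a ≡ factorEigenvalue α * projFactor α a
  projFactor-eigen zero    = completeAdj-const 1ℚ
  projFactor-eigen (suc c) = completeAdj-sumZero (projFactor (suc c)) (sumL-projFactor c)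

  dualFactor-eigen : ∀ α a → completeAdj (dualFactor α) a ≡ factorEigenvalue α * dualFactor α a
  dualFactor-eigen zero    = completeAdj-const E⁻¹
  dualFactor-eigen (suc c) = completeAdj-sumZero (dualFactor (suc c)) (sumL-dualFactor c)

  π ψ : ∀ {d} → W d e → Fun d e
  π = tensor projFactor
  ψ = tensor dualFactor

  eigenvalue : ℕ → ℕ → ℚ
  eigenvalue d k = toℚ d * (E - 1ℚ) - toℚ k * E

  eigenvalue-anti-< : ∀ d {k k′} → k ℕ.< k′ → eigenvalue d k′ ℚ.< eigenvalue d k
  eigenvalue-anti-< d k<k′ =
    ℚ.+-monoʳ-< (toℚ d * (E - 1ℚ)) (ℚ.neg-antimono-< (ℚ.*-monoˡ-<-pos E (toℚ-mono-< k<k′)))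

  eigenvalue-injective : ∀ d {k k′} → eigenvalue d k ≡ eigenvalue d k′ → k ≡ k′
  eigenvalue-injective d {k} {k′} eq with ℕ.<-cmp k k′
  ... | tri< k<k′ _ _ = ⊥-elim (ℚ.<-irrefl (sym eq) (eigenvalue-anti-< d k<k′))
  ... | tri≈ _ k≡k′ _ = k≡k′
  ... | tri> _ _ k>k′ = ⊥-elim (ℚ.<-irrefl eq (eigenvalue-anti-< d k>k′))

  tensorEigenvalue-factorEigenvalue : ∀ {d} (v : W d e) →
    tensorEigenvalue factorEigenvalue v ≡ eigenvalue d (nonzeroCount v)
  tensorEigenvalue-factorEigenvalue [] =
    solve 1 (λ E → con 0ℚ := con 0ℚ :* (E :- con 1ℚ) :- con 0ℚ :* E) refl E
  tensorEigenvalue-factorEigenvalue {suc d} (zero ∷ v) =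
    trans (cong (E - 1ℚ +_) (tensorEigenvalue-factorEigenvalue v))
      (solve 3 (λ E a b → (E :- con 1ℚ) :+ (a :* (E :- con 1ℚ) :- b :* E)
                       := (con 1ℚ :+ a) :* (E :- con 1ℚ) :- b :* E) refl E (toℚ d) (toℚ (nonzeroCount v)))
  tensorEigenvalue-factorEigenvalue {suc d} (suc c ∷ v) =
    trans (cong (- 1ℚ +_) (tensorEigenvalue-factorEigenvalue v))
      (solve 3 (λ E a b → (:- con 1ℚ) :+ (a :* (E :- con 1ℚ) :- b :* E)
                       := (con 1ℚ :+ a) :* (E :- con 1ℚ) :- (con 1ℚ :+ b) :* E) refl E (toℚ d) (toℚ (nonzeroCount v)))

  π-eigen : ∀ {d} (v : W d e) → InEigenspace (eigenvalue d (nonzeroCount v)) (π v)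
  π-eigen v = subst (λ θ → InEigenspace θ (π v)) (tensorEigenvalue-factorEigenvalue v)
    (tensor-eigen projFactor factorEigenvalue projFactor-eigen v)

  ψ-eigen : ∀ {d} (v : W d e) → InEigenspace (eigenvalue d (nonzeroCount v)) (ψ v)
  ψ-eigen v = subst (λ θ → InEigenspace θ (ψ v)) (tensorEigenvalue-factorEigenvalue v)
    (tensor-eigen dualFactor factorEigenvalue dualFactor-eigen v)

  sumL-dual-proj : ∀ a b → sumL (allFin (suc e))
    (λ α → if does (α Fin.≟ fromℕ e) then 0ℚ else dualFactor α b * projFactor α a) ≡ δ a b
  sumL-dual-proj a b = begin
    sumL (allFin (suc e)) term
      ≡⟨ sumL-allFin-suc e term ⟩
    E⁻¹ * 1ℚ + sumL (allFin e) (term ∘ suc)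
      ≡⟨ cong (E⁻¹ * 1ℚ +_) (sumL-cong (allFin e) unguard) ⟩
    E⁻¹ * 1ℚ + sumL (allFin e) (λ c → δ b c * G c - δ lastLetter b * G c)
      ≡⟨ cong (E⁻¹ * 1ℚ +_) (sumL-sub (allFin e) (λ c → δ b c * G c) (λ c → δ lastLetter b * G c)) ⟩
    E⁻¹ * 1ℚ + (sumL (allFin e) (λ c → δ b c * G c) - sumL (allFin e) (λ c → δ lastLetter b * G c))
      ≡⟨ cong₂ (λ p q → E⁻¹ * 1ℚ + (p - q)) (sumL-δ e b G)
           (trans (sumL-*ˡ (allFin e) (δ lastLetter b) G) (*-≡0ʳ (δ lastLetter b) ΣG≡0)) ⟩
    E⁻¹ * 1ℚ + (δ b a - E⁻¹ - 0ℚ)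
      ≡⟨ solve 2 (λ i x → i :* con 1ℚ :+ (x :- i :- con 0ℚ) := x) refl E⁻¹ (δ b a) ⟩
    δ b a
      ≡⟨ δ-sym b a ⟩
    δ a b ∎
    where
    open ≡-Reasoning
    term : Fin (suc e) → ℚ
    term α = if does (α Fin.≟ fromℕ e) then 0ℚ else dualFactor α b * projFactor α a
    G : Fin e → ℚ
    G c = δ c a - E⁻¹
    ΣG≡0 : sumL (allFin e) G ≡ 0ℚ
    ΣG≡0 = trans (sumL-cong (allFin e) (λ c → cong (_- E⁻¹) (δ-sym c a))) (sumL-projFactor a)
    -- The guard only removes c = lastLetter, where δ c b - δ lastLetter b vanishes anyway.
    unguard : ∀ c → term (suc c) ≡ δ b c * G c - δ lastLetter b * G c
    unguard c with c Fin.≟ lastLetter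
    ... | yes refl = sym (trans (cong (λ z → z * G c - δ c b * G c) (δ-sym b c)) (ℚ.+-inverseʳ (δ c b * G c)))
    ... | no  _    = trans (cong (λ z → (z - δ lastLetter b) * G c) (δ-sym c b))
      (solve 3 (λ x y g → (x :- y) :* g := x :* g :- y :* g) refl (δ b c) (δ lastLetter b) (G c))

  dual-completeness : ∀ {d} (x y : X d e) →
    sumL (Ws d e) (λ v → if noLetterEB v then ψ v y * π v x else 0ℚ) ≡ δV x y
  dual-completeness []      []      = trans (ℚ.+-identityʳ (1ℚ * 1ℚ)) (ℚ.*-identityˡ 1ℚ)
  dual-completeness {suc d} (a ∷ x) (b ∷ y) =
    trans (sumL-words-suc (allFin (suc e)) d (summand (a ∷ x) (b ∷ y)))
    (trans (sumL-cong (allFin (suc e)) (λ α → trans (sumL-cong (Ws d e) (factor α))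
             (trans (sumL-*ˡ (Ws d e) (head α) (summand x y)) (cong (head α *_) (dual-completeness x y)))))
    (trans (sumL-*ʳ (allFin (suc e)) (δV x y) head) (cong (_* δV x y) (sumL-dual-proj a b))))
    where
    summand : ∀ {d} → X d e → X d e → W d e → ℚ
    summand x y v = if noLetterEB v then ψ v y * π v x else 0ℚ
    head : Fin (suc e) → ℚ
    head α = if does (α Fin.≟ fromℕ e) then 0ℚ else dualFactor α b * projFactor α a
    factor : ∀ α v → summand (a ∷ x) (b ∷ y) (α ∷ v) ≡ head α * summand x y v
    factor α v with does (α Fin.≟ fromℕ e)
    ... | true  = sym (ℚ.*-zeroˡ (summand x y v))
    ... | false with noLetterEB v
    ...   | true  = solve 4 (λ p q r s → (p :* q) :* (r :* s) := (p :* r) :* (q :* s)) refl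
                      (dualFactor α b) (ψ v y) (projFactor α a) (π v x)
    ...   | false = sym (ℚ.*-zeroʳ (dualFactor α b * projFactor α a))

  noLetterEB-∷ : ∀ {d} α (v : W d e) → noLetterEB (α ∷ v) ≡ true →
    does (α Fin.≟ fromℕ e) ≡ false × noLetterEB v ≡ true
  noLetterEB-∷ α v h with does (α Fin.≟ fromℕ e)
  noLetterEB-∷ α v () | true
  noLetterEB-∷ α v h  | false = refl , h

  inner₁-dual-proj : ∀ β α → does (α Fin.≟ fromℕ e) ≡ false → inner₁ dualFactor projFactor β α ≡ δ β α
  inner₁-dual-proj zero zero _ =
    trans (sumL-const e (E⁻¹ * 1ℚ)) (trans (cong (E *_) (ℚ.*-identityʳ E⁻¹)) (ℚ.*-inverseʳ E))
  inner₁-dual-proj (suc c′) zero _ =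
    trans (sumL-cong (allFin e) (λ a → ℚ.*-identityʳ (dualFactor (suc c′) a))) (sumL-dualFactor c′)
  inner₁-dual-proj zero (suc c) _ =
    trans (sumL-*ˡ (allFin e) E⁻¹ (projFactor (suc c))) (*-≡0ʳ E⁻¹ (sumL-projFactor c))
  inner₁-dual-proj (suc c′) (suc c) c≢last = begin
    sumL (allFin e) (λ a → (δ c′ a - δ lastLetter a) * (δ c a - E⁻¹))
      ≡⟨ sumL-δ-δ e c′ lastLetter (λ a → δ c a - E⁻¹) ⟩
    (δ c c′ - E⁻¹) - (δ c lastLetter - E⁻¹)
      ≡⟨ cong (λ z → (δ c c′ - E⁻¹) - (z - E⁻¹)) (cong (λ t → if t then 1ℚ else 0ℚ) c≢last) ⟩
    (δ c c′ - E⁻¹) - (0ℚ - E⁻¹)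
      ≡⟨ solve 2 (λ x i → (x :- i) :- (con 0ℚ :- i) := x) refl (δ c c′) E⁻¹ ⟩
    δ c c′
      ≡⟨ δ-sym c c′ ⟩
    δ c′ c ∎
    where open ≡-Reasoning

  inner-ψ-π : ∀ {d} (w v : W d e) → noLetterEB v ≡ true → inner (ψ w) (π v) ≡ δV w v
  inner-ψ-π w v h = trans (inner-tensor dualFactor projFactor w v) (factorwise w v h)
    where
    factorwise : ∀ {d} (w v : W d e) → noLetterEB v ≡ true → factorwiseInner dualFactor projFactor w v ≡ δV w v
    factorwise []      []      _ = refl
    factorwise (β ∷ w) (α ∷ v) h =
      cong₂ _*_ (inner₁-dual-proj β α (proj₁ (noLetterEB-∷ α v h))) (factorwise w v (proj₂ (noLetterEB-∷ α v h)))

  indic≡tensor : ∀ {d} (v : W d e) x → indic v x ≡ tensor indicatorFactor v x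
  indic≡tensor []          []      = refl
  indic≡tensor (zero  ∷ v) (a ∷ x) = trans (indic≡tensor v x) (sym (ℚ.*-identityˡ (tensor indicatorFactor v x)))
  indic≡tensor (suc c ∷ v) (a ∷ x) with does (c Fin.≟ a)
  ... | true  = trans (indic≡tensor v x) (sym (ℚ.*-identityˡ (tensor indicatorFactor v x)))
  ... | false = sym (ℚ.*-zeroˡ (tensor indicatorFactor v x))

  inner₁-proj-zero-suc : ∀ c → inner₁ projFactor projFactor zero (suc c) ≡ 0ℚ
  inner₁-proj-zero-suc c =
    trans (sumL-cong (allFin e) (λ a → ℚ.*-identityˡ (projFactor (suc c) a))) (sumL-projFactor c)

  inner₁-proj-suc-zero : ∀ c → inner₁ projFactor projFactor (suc c) zero ≡ 0ℚ
  inner₁-proj-suc-zero c =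
    trans (sumL-cong (allFin e) (λ a → ℚ.*-identityʳ (projFactor (suc c) a))) (sumL-projFactor c)

  inner₁-indicator-proj : ∀ c′ c →
    inner₁ indicatorFactor projFactor (suc c′) (suc c) ≡ inner₁ projFactor projFactor (suc c′) (suc c)
  inner₁-indicator-proj c′ c = trans (sumL-δ e c′ G) (sym (begin
    sumL (allFin e) (λ a → (δ c′ a - E⁻¹) * G a)
      ≡⟨ sumL-cong (allFin e) (λ a → solve 3 (λ x i g → (x :- i) :* g := x :* g :- i :* g) refl (δ c′ a) E⁻¹ (G a)) ⟩
    sumL (allFin e) (λ a → δ c′ a * G a - E⁻¹ * G a)
      ≡⟨ sumL-sub (allFin e) (λ a → δ c′ a * G a) (λ a → E⁻¹ * G a) ⟩
    sumL (allFin e) (λ a → δ c′ a * G a) - sumL (allFin e) (λ a → E⁻¹ * G a)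
      ≡⟨ cong₂ _-_ (sumL-δ e c′ G) (trans (sumL-*ˡ (allFin e) E⁻¹ G) (*-≡0ʳ E⁻¹ (sumL-projFactor c))) ⟩
    G c′ - 0ℚ
      ≡⟨ solve 1 (λ x → x :- con 0ℚ := x) refl (G c′) ⟩
    G c′ ∎))
    where
    open ≡-Reasoning
    G : Fin e → ℚ
    G = projFactor (suc c)

  -- If v has fewer nonzero entries than w, some position is zero in v but not in w.
  factorwiseInner-indicator-proj-< : ∀ {d} (v w : W d e) → nonzeroCount v ℕ.< nonzeroCount w →
    factorwiseInner indicatorFactor projFactor v w ≡ 0ℚ
  factorwiseInner-indicator-proj-< (zero   ∷ v) (zero  ∷ w) v<w =
    *-≡0ʳ (inner₁ indicatorFactor projFactor zero zero) (factorwiseInner-indicator-proj-< v w v<w)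
  factorwiseInner-indicator-proj-< (zero   ∷ v) (suc c ∷ w) _ =
    *-≡0ˡ (factorwiseInner indicatorFactor projFactor v w) (inner₁-proj-zero-suc c)
  factorwiseInner-indicator-proj-< (suc c′ ∷ v) (zero  ∷ w) v<w =
    *-≡0ʳ (inner₁ indicatorFactor projFactor (suc c′) zero) (factorwiseInner-indicator-proj-< v w (ℕ.<⇒≤ v<w))
  factorwiseInner-indicator-proj-< (suc c′ ∷ v) (suc c ∷ w) (s≤s v<w) =
    *-≡0ʳ (inner₁ indicatorFactor projFactor (suc c′) (suc c)) (factorwiseInner-indicator-proj-< v w v<w)

  factorwiseInner-indicator-proj : ∀ {d} (v w : W d e) → nonzeroCount v ≤ nonzeroCount w →
    factorwiseInner indicatorFactor projFactor v w ≡ factorwiseInner projFactor projFactor v w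
  factorwiseInner-indicator-proj []           []          _ = refl
  factorwiseInner-indicator-proj (zero   ∷ v) (zero  ∷ w) v≤w =
    cong (inner₁ projFactor projFactor zero zero *_) (factorwiseInner-indicator-proj v w v≤w)
  factorwiseInner-indicator-proj (zero   ∷ v) (suc c ∷ w) _ =
    trans (*-≡0ˡ (factorwiseInner indicatorFactor projFactor v w) (inner₁-proj-zero-suc c))
          (sym (*-≡0ˡ (factorwiseInner projFactor projFactor v w) (inner₁-proj-zero-suc c)))
  factorwiseInner-indicator-proj (suc c′ ∷ v) (zero  ∷ w) v<w =
    trans (*-≡0ʳ (inner₁ indicatorFactor projFactor (suc c′) zero) (factorwiseInner-indicator-proj-< v w v<w))
          (sym (*-≡0ˡ (factorwiseInner projFactor projFactor v w) (inner₁-proj-suc-zero c′)))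
  factorwiseInner-indicator-proj (suc c′ ∷ v) (suc c ∷ w) (s≤s v≤w) =
    cong₂ _*_ (inner₁-indicator-proj c′ c) (factorwiseInner-indicator-proj v w v≤w)

  inner-indic-π : ∀ {d} (v w : W d e) → nonzeroCount v ≤ nonzeroCount w →
    inner (indic v) (π w) ≡ inner (π v) (π w)
  inner-indic-π v w v≤w = begin
    inner (indic v) (π w)                           ≡⟨ inner-congˡ (π w) (indic≡tensor v) ⟩
    inner (tensor indicatorFactor v) (π w)          ≡⟨ inner-tensor indicatorFactor projFactor v w ⟩
    factorwiseInner indicatorFactor projFactor v w  ≡⟨ factorwiseInner-indicator-proj v w v≤w ⟩
    factorwiseInner projFactor projFactor v w       ≡⟨ inner-tensor projFactor projFactor v w ⟨
    inner (π v) (π w)                               ∎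
    where open ≡-Reasoning

module Expansion (m d : ℕ) where

  open HammingFactors m public

  coeff : Fun d e → W d e → ℚ
  coeff f v = inner (ψ v) f

  coeff-eigen : ∀ θ f → InEigenspace θ f → ∀ v →
    θ * coeff f v ≡ eigenvalue d (nonzeroCount v) * coeff f v
  coeff-eigen θ f f-eigen v = begin
    θ * inner (ψ v) f             ≡⟨ inner-*ʳ (ψ v) f θ ⟨
    inner (ψ v) (λ x → θ * f x)   ≡⟨ inner-congʳ (ψ v) (λ x → sym (f-eigen x)) ⟩
    inner (ψ v) (adjMat f)        ≡⟨ adjMat-selfAdjoint (ψ v) f ⟨
    inner (adjMat (ψ v)) f        ≡⟨ inner-congˡ f (ψ-eigen v) ⟩
    inner (λ x → θᵥ * ψ v x) f    ≡⟨ inner-*ˡ (ψ v) f θᵥ ⟩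
    θᵥ * inner (ψ v) f            ∎
    where
    open ≡-Reasoning
    θᵥ : ℚ
    θᵥ = eigenvalue d (nonzeroCount v)

  coeff-vanishes : ∀ θ f → InEigenspace θ f → ∀ v → θ ≢ eigenvalue d (nonzeroCount v) → coeff f v ≡ 0ℚ
  coeff-vanishes θ f f-eigen v = *-eqʳ⇒≡0 θ _ (coeff f v) (coeff-eigen θ f f-eigen v)

  expansion : ∀ f x → f x ≡ sumL (Ws d e) (λ v → if noLetterEB v then coeff f v * π v x else 0ℚ)
  expansion f x = sym (begin
    sumL (Ws d e) (λ v → if noLetterEB v then coeff f v * π v x else 0ℚ)
      ≡⟨ sumL-cong (Ws d e) expand-coeff ⟩
    sumL (Ws d e) (λ v → sumL (Xs d e) (λ y → K v y * f y))
      ≡⟨ sumL-swap (Ws d e) (Xs d e) (λ v y → K v y * f y) ⟩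
    sumL (Xs d e) (λ y → sumL (Ws d e) (λ v → K v y * f y))
      ≡⟨ sumL-cong (Xs d e) (λ y → trans (sumL-*ʳ (Ws d e) (f y) (λ v → K v y))
                                         (cong (_* f y) (dual-completeness x y))) ⟩
    sumL (Xs d e) (λ y → δV x y * f y)
      ≡⟨ sumL-δV e d x f ⟩
    f x ∎)
    where
    open ≡-Reasoning
    K : W d e → X d e → ℚ
    K v y = if noLetterEB v then ψ v y * π v x else 0ℚ
    expand-coeff : ∀ v → (if noLetterEB v then coeff f v * π v x else 0ℚ) ≡ sumL (Xs d e) (λ y → K v y * f y)
    expand-coeff v with noLetterEB v
    ... | true  = trans (sym (sumL-*ʳ (Xs d e) (π v x) (λ y → ψ v y * f y)))
      (sumL-cong (Xs d e) (λ y → solve 3 (λ a b c → (a :* b) :* c := (a :* c) :* b) refl (ψ v y) (f y) (π v x)))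
    ... | false = sym (sumL-≡0 (Xs d e) (λ y → ℚ.*-zeroˡ (f y)))

module Eigenspace (m d k : ℕ) where

  open Expansion m d public

  θₖ : ℚ
  θₖ = eigenvalue d k

  InL'-elim : ∀ (v : W d e) → InL' k v → nonzeroCount v ≡ k × noLetterEB v ≡ true
  InL'-elim v = if-does-elim (nonzeroCount v ℕ.≟ k)

  InL'-intro : ∀ (v : W d e) → nonzeroCount v ≡ k → noLetterEB v ≡ true → InL' k v
  InL'-intro v = if-does-intro (nonzeroCount v ℕ.≟ k)

  π-eigenₖ : ∀ v → InL' k v → InEigenspace θₖ (π v)
  π-eigenₖ v v∈ = subst (λ j → InEigenspace (eigenvalue d j) (π v)) (proj₁ (InL'-elim v v∈)) (π-eigen v)

  ψ-eigenₖ : ∀ v → InL' k v → InEigenspace θₖ (ψ v)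
  ψ-eigenₖ v v∈ = subst (λ j → InEigenspace (eigenvalue d j) (ψ v)) (proj₁ (InL'-elim v v∈)) (ψ-eigen v)

  coeff-outside : ∀ f → InEigenspace θₖ f → ∀ v → noLetterEB v ≡ true → inL'B k v ≡ false → coeff f v ≡ 0ℚ
  coeff-outside f f-eigen v noLetter v∉ = coeff-vanishes θₖ f f-eigen v
    (λ eq → true≢false (trans (sym (InL'-intro v (sym (eigenvalue-injective d eq)) noLetter)) v∉))
    where
    true≢false : true ≢ false
    true≢false ()

  spanning : ∀ (b : W d e → Fun d e) → (∀ v → InL' k v → ∀ x → b v x ≡ π v x) →
    ∀ f → InEigenspace θₖ f → ∀ x → f x ≡ linComb k (coeff f) b x
  spanning b b≡π f f-eigen x = trans (expansion f x) (sumL-cong (Ws d e) summand)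
    where
    summand : ∀ v → (if noLetterEB v then coeff f v * π v x else 0ℚ)
                  ≡ (if inL'B k v then coeff f v * b v x else 0ℚ)
    summand v with inL'B k v in v∈?
    ... | true rewrite proj₂ (InL'-elim v v∈?) = cong (coeff f v *_) (sym (b≡π v v∈? x))
    ... | false = if-then-≡0 (noLetterEB v) (λ noLetter → *-≡0ˡ (π v x) (coeff-outside f f-eigen v noLetter v∈?))

  indic-π-orthogonal : ∀ v → InL' k v → ∀ h → InEigenspace θₖ h → inner (λ x → indic v x - π v x) h ≡ 0ℚ
  indic-π-orthogonal v v∈ h h-eigen = begin
    inner (λ x → indic v x - π v x) h
      ≡⟨ inner-congʳ (λ x → indic v x - π v x) (spanning π (λ _ _ _ → refl) h h-eigen) ⟩
    inner (λ x → indic v x - π v x) (linComb k (coeff h) π)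
      ≡⟨ inner-linComb k (λ x → indic v x - π v x) (coeff h) π ⟩
    sumL (Ws d e) (λ w → if inL'B k w then coeff h w * inner (λ x → indic v x - π v x) (π w) else 0ℚ)
      ≡⟨ sumL-≡0 (Ws d e) (λ w → if-then-≡0 (inL'B k w) (λ w∈ → *-≡0ʳ (coeff h w) (orthogonal w w∈))) ⟩
    0ℚ ∎
    where
    open ≡-Reasoning
    orthogonal : ∀ w → InL' k w → inner (λ x → indic v x - π v x) (π w) ≡ 0ℚ
    orthogonal w w∈ = trans (inner-subˡ (indic v) (π v) (π w))
      (trans (cong (_- inner (π v) (π w))
                   (inner-indic-π v w (ℕ.≤-reflexive (trans (proj₁ (InL'-elim v v∈)) (sym (proj₁ (InL'-elim w w∈)))))))
             (ℚ.+-inverseʳ (inner (π v) (π w))))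

  -- π v − p lies in V_k and is orthogonal to every ψ w with w ∈ L'_k, so all its coefficients vanish.
  orthProj-unique : ∀ v → InL' k v → ∀ p → IsOrthProj θₖ (indic v) p → ∀ x → p x ≡ π v x
  orthProj-unique v v∈ p (p-eigen , p-orth) x = sym (begin
    π v x                      ≡⟨ solve 2 (λ a b → a := b :+ (a :- b)) refl (π v x) (p x) ⟩
    p x + D x                  ≡⟨ cong (p x +_) (spanning π (λ _ _ _ → refl) D D-eigen x) ⟩
    p x + linComb k (coeff D) π x
      ≡⟨ cong (p x +_) (sumL-≡0 (Ws d e) (λ w → if-then-≡0 (inL'B k w) (λ w∈ → *-≡0ˡ (π w x) (coeff-D w w∈)))) ⟩
    p x + 0ℚ                   ≡⟨ ℚ.+-identityʳ (p x) ⟩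
    p x                        ∎)
    where
    open ≡-Reasoning
    D : Fun d e
    D y = π v y - p y
    D-eigen : InEigenspace θₖ D
    D-eigen y = trans (adjMat-sub (π v) p y) (trans (cong₂ _-_ (π-eigenₖ v v∈ y) (p-eigen y))
      (solve 3 (λ t a b → t :* a :- t :* b := t :* (a :- b)) refl θₖ (π v y) (p y)))
    coeff-D : ∀ w → InL' k w → coeff D w ≡ 0ℚ
    coeff-D w w∈ = begin
      inner (ψ w) D
        ≡⟨ inner-comm (ψ w) D ⟩
      inner D (ψ w)
        ≡⟨ inner-congˡ (ψ w) (λ y → solve 3 (λ i a b → a :- b := (i :- b) :- (i :- a)) refl
                                      (indic v y) (π v y) (p y)) ⟩
      inner (λ y → (indic v y - p y) - (indic v y - π v y)) (ψ w)
        ≡⟨ inner-subˡ (λ y → indic v y - p y) (λ y → indic v y - π v y) (ψ w) ⟩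
      inner (λ y → indic v y - p y) (ψ w) - inner (λ y → indic v y - π v y) (ψ w)
        ≡⟨ cong₂ _-_ (p-orth (ψ w) (ψ-eigenₖ w w∈)) (indic-π-orthogonal v v∈ (ψ w) (ψ-eigenₖ w w∈)) ⟩
      0ℚ - 0ℚ
        ≡⟨ ℚ.+-inverseʳ 0ℚ ⟩
      0ℚ ∎

  independent : ∀ (b : W d e → Fun d e) → (∀ v → InL' k v → ∀ x → b v x ≡ π v x) →
    ∀ (c : W d e → ℚ) → (∀ x → linComb k c b x ≡ 0ℚ) → ∀ w → InL' k w → c w ≡ 0ℚ
  independent b b≡π c trivial w w∈ = begin
    c w
      ≡⟨ cong (λ t → if t then c w else 0ℚ) w∈ ⟨
    (if inL'B k w then c w else 0ℚ)
      ≡⟨ sumL-δV (suc e) d w (λ v → if inL'B k v then c v else 0ℚ) ⟨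
    sumL (Ws d e) (λ v → δV w v * (if inL'B k v then c v else 0ℚ))
      ≡⟨ sumL-cong (Ws d e) dual ⟨
    sumL (Ws d e) (λ v → if inL'B k v then c v * inner (ψ w) (b v) else 0ℚ)
      ≡⟨ inner-linComb k (ψ w) c b ⟨
    inner (ψ w) (linComb k c b)
      ≡⟨ inner-congʳ (ψ w) trivial ⟩
    inner (ψ w) (λ _ → 0ℚ)
      ≡⟨ sumL-≡0 (Xs d e) (λ x → ℚ.*-zeroʳ (ψ w x)) ⟩
    0ℚ ∎
    where
    open ≡-Reasoning
    dual : ∀ v → (if inL'B k v then c v * inner (ψ w) (b v) else 0ℚ)
               ≡ δV w v * (if inL'B k v then c v else 0ℚ)
    dual v with inL'B k v in v∈
    ... | true  = trans (cong (c v *_) (trans (inner-congʳ (ψ w) (b≡π v v∈))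
                                              (inner-ψ-π w v (proj₂ (InL'-elim v v∈)))))
                        (ℚ.*-comm (c v) (δV w v))
    ... | false = sym (ℚ.*-zeroʳ (δV w v))

  basis : (∀ (v : W d e) → InL' k v → ∃ λ g → IsOrthProj θₖ (indic v) g) ×
          (∀ (p : W d e → Fun d e) → (∀ v → InL' k v → IsOrthProj θₖ (indic v) (p v)) → IsBasisL' k θₖ p)
  basis = (λ v v∈ → π v , π-eigenₖ v v∈ , indic-π-orthogonal v v∈)
        , λ p p-proj →
            let p≡π : ∀ v → InL' k v → ∀ x → p v x ≡ π v x
                p≡π v v∈ = orthProj-unique v v∈ (p v) (p-proj v v∈)
            in (λ v v∈ → proj₁ (p-proj v v∈))
             , independent p p≡π
             , (λ f f-eigen → coeff f , spanning p p≡π f f-eigen)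

module Spectrum (m d : ℕ) where

  open Expansion m d

  eigenvalue-in-range : ∀ μ → IsEigenvalue d e μ → ∃ λ (k : Fin (suc d)) → μ ≡ eigenvalue d (toℕ k)
  eigenvalue-in-range μ (f , (x₀ , fx₀≢0) , f-eigen) with Fin.any? (λ k → μ ℚ.≟ eigenvalue d (toℕ k))
  ... | yes found = found
  ... | no  none  = ⊥-elim (fx₀≢0 (trans (expansion f x₀) (sumL-≡0 (Ws d e) (λ v →
      if-then-≡0 (noLetterEB v) (λ _ → *-≡0ˡ (π v x₀) (coeff-vanishes μ f f-eigen v (μ≢ v)))))))
    where
    μ≢ : ∀ v → μ ≢ eigenvalue d (nonzeroCount v)
    μ≢ v eq = none (fromℕ< (s≤s (nonzeroCount≤ v)) ,
                    trans eq (cong (eigenvalue d) (sym (Fin.toℕ-fromℕ< (s≤s (nonzeroCount≤ v))))))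

  eigenvalueList≡ : ∀ θ → IsEigenvalueList d e θ → ∀ i → θ i ≡ eigenvalue d (toℕ i)
  eigenvalueList≡ θ (decreasing , θ-eigen , _) i =
    trans (θ≡σ i) (cong (eigenvalue d ∘ toℕ) (strictlyIncreasing⇒≡id σ increasing i))
    where
    σ : Fin (suc d) → Fin (suc d)
    σ i = proj₁ (eigenvalue-in-range (θ i) (θ-eigen i))
    θ≡σ : ∀ i → θ i ≡ eigenvalue d (toℕ (σ i))
    θ≡σ i = proj₂ (eigenvalue-in-range (θ i) (θ-eigen i))
    increasing : ∀ i j → i Fin.< j → σ i Fin.< σ j
    increasing i j i<j with ℕ.<-cmp (toℕ (σ i)) (toℕ (σ j))
    ... | tri< σi<σj _ _ = σi<σj
    ... | tri≈ _ σi≡σj _ = ⊥-elim (ℚ.<-irrefl θj≡θi (decreasing i j i<j))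
      where
      θj≡θi : θ j ≡ θ i
      θj≡θi = trans (θ≡σ j) (trans (cong (eigenvalue d) (sym σi≡σj)) (sym (θ≡σ i)))
    ... | tri> _ _ σi>σj = ⊥-elim (ℚ.<-asym (decreasing i j i<j)
      (subst₂ ℚ._<_ (sym (θ≡σ i)) (sym (θ≡σ j)) (eigenvalue-anti-< d σi>σj)))

proposition3p3 : (d e : ℕ) → 2 ≤ e →
    (θ : Fin (suc d) → ℚ) → IsEigenvalueList d e θ →
    (i : Fin (suc d)) →
      (∀ (v : W d e) → InL' (toℕ i) v → ∃ λ g → IsOrthProj (θ i) (indic v) g) ×
      (∀ (p : W d e → Fun d e) →
         (∀ v → InL' (toℕ i) v → IsOrthProj (θ i) (indic v) (p v)) →
         IsBasisL' (toℕ i) (θ i) p)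
-- 2 ≤ e only excludes e = 0; the argument works for every e ≥ 1.
proposition3p3 d zero    ()
proposition3p3 d (suc m) _  θ θ-list i rewrite Spectrum.eigenvalueList≡ m d θ θ-list i =
  Eigenspace.basis m d (toℕ i)
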